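{- Let $k\ge 2$ and let $A=\{a_1,\dots,a_k\}$ be positive integers with $\gcd(a_1,\dots,a_k)=1$. For $1\le i\le a_1-1$ let $m_i$ be the least positive integer with $m_i\equiv i\pmod{a_1}$ and $m_i\in{\rm R}(A)$. If $\lambda$ is a complex number with $\lambda\ne 0$, $\lambda\ne 1$ and $\lambda^{a_1}=1$, then $$ \sum_{n\in{\rm NR}(A)}\lambda^n n=\frac{1}{2 a_1}\sum_{i=1}^{a_1-1}m_i^2\lambda^i-\frac{1}{2}\sum_{i=1}^{a_1-1}m_i\lambda^i+\frac{\lambda}{(\lambda-1)^2}. $$
   Context: ${\rm R}(A)$ denotes the set of positive integers that can be written as $x_1a_1+\dots+x_ka_k$ with nonnegative integers $x_i$, and ${\rm NR}(A)$ denotes the (finite) set of positive integers not in ${\rm R}(A)$. -}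

module Defs where

open import Level using (Level; suc; _⊔_)
open import Data.Nat as ℕ using (ℕ; zero; _<_; ∣_-_∣)
open import Data.Nat.Divisibility using (_∣_)
open import Data.Nat.ListAction using (sum)
open import Data.Nat.GCD using (gcd)
open import Data.List using (List; []; _∷_; foldr; zipWith; length)
open import Data.Product using (Σ; ∃; _×_)
open import Relation.Binary.PropositionalEquality using (_≡_)
open import Relation.Nullary using (¬_)
open import Algebra.Bundles using (CommutativeRing)

gcdList : List ℕ → ℕ
gcdList = foldr gcd 0

InR : List ℕ → ℕ → Set
InR A n = 0 < n × Σ (List ℕ) (λ xs → length xs ≡ length A × n ≡ sum (zipWith ℕ._*_ xs A))

InNR : List ℕ → ℕ → Set
InNR A n = 0 < n × ¬ InR A n

_≡_[mod_] : ℕ → ℕ → ℕ → Set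
m ≡ i [mod a ] = a ∣ ∣ m - i ∣

IsLeastRep : List ℕ → ℕ → ℕ → ℕ → Set
IsLeastRep A a₁ i m =
  (m ≡ i [mod a₁ ] × InR A m) ×
  (∀ m′ → 0 < m′ → m′ ≡ i [mod a₁ ] → InR A m′ → m ℕ.≤ m′)

module RingOps {c ℓ} (R : CommutativeRing c ℓ) where
  open CommutativeRing R
  ι : ℕ → Carrier
  ι zero = 0#
  ι (ℕ.suc n) = 1# + ι n
  _^_ : Carrier → ℕ → Carrier
  x ^ zero = 1#
  x ^ ℕ.suc n = x * (x ^ n)
  Σ[_]_ : List ℕ → (ℕ → Carrier) → Carrier
  Σ[ L ] f = foldr (λ n s → f n + s) 0# L

-- A field of characteristic zero (the complex numbers are an instance).
record CharZeroField (c ℓ : Level) : Set (Level.suc (c ⊔ ℓ)) where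
  field
    cring : CommutativeRing c ℓ
  open CommutativeRing cring
  open RingOps cring
  field
    0≉1 : ¬ (0# ≈ 1#)
    inverse : ∀ x → ¬ (x ≈ 0#) → Σ Carrier (λ y → y * x ≈ 1#)
    charZero : ∀ n → ¬ (ι (ℕ.suc n) ≈ 0#)
  open CommutativeRing cring public
  open RingOps cring public

{-# OPTIONS --safe #-}
-- Write a = a₁ and m_r = t_r a + r. Since m_r is the least representable number ≡ r (mod a) and
-- adding a preserves representability, the non-representable numbers ≡ r are exactly q a + r with
-- q < t_r, while no multiple of a is non-representable. As λ^a = 1 the sum is therefore
-- Σ_r λ^r Σ_{q<t_r} (q a + r), and with Q(n) = n² − a n one has 2a Σ_{q<t} (q a + r) = Q(t a + r) − Q(r).
-- What remains is Σ_{r<a} λ^r Q(r) = −2aλ/(λ−1)², which follows from the telescoping identities for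
-- (λ−1) Σ_{r<n} λ^r r^j (j = 0, 1, 2) at n = a, where λ^a = 1 and λ − 1 is invertible.
module Submission where

open import Defs
open import Data.Nat as ℕ using (ℕ; suc; _<_; _≤_; _∸_)
open import Data.List using (List; _∷_; length; map; upTo)
open import Data.List.Relation.Unary.All using (All)
open import Data.List.Relation.Unary.Unique.Propositional using (Unique)
open import Data.List.Membership.Propositional using (_∈_)
open import Function.Bundles using (_⇔_)
open import Relation.Binary.PropositionalEquality using (_≡_)
open import Relation.Nullary using (¬_)

open import Algebra.Bundles using (CommutativeRing)
import Algebra.Solver.Ring
open import Algebra.Solver.Ring.AlmostCommutativeRing using (fromCommutativeRing; _-Raw-AlmostCommutative⟶_)
open import Data.Bool using (if_then_else_)
open import Data.Empty using (⊥-elim)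
open import Data.Integer as ℤ using (ℤ; -[1+_]; _⊖_)
import Data.Integer.Properties as ℤ
open import Data.List using ([]; [_]; replicate; zipWith; applyUpTo)
import Data.List.Properties as List
open import Data.List.Membership.DecPropositional ℕ._≟_ using (_∉_; _∈?_)
open import Data.List.Relation.Unary.All as All using (_∷_)
open import Data.List.Relation.Unary.All.Properties using (All¬⇒¬Any)
open import Data.List.Relation.Unary.AllPairs using (_∷_)
open import Data.List.Relation.Unary.Any using (here; there)
import Data.Maybe as Maybe
open import Data.Nat using (zero; z≤n; s≤s; ∣_-_∣; NonZero)
import Data.Nat.Properties as ℕ
open import Data.Nat.DivMod using (_/_; _%_; m≡m%n+[m/n]*n; %-remove-+ˡ; m<n⇒m%n≡m)
open import Data.Nat.Divisibility using (_∣_; n∣m*n; ∣⇒≤)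
open import Data.Nat.ListAction using (sum)
open import Data.Nat.Tactic.RingSolver using (solve-∀)
open import Data.Product using (_,_; proj₁; proj₂)
open import Function using (_∘_; Equivalence)
open import Relation.Binary.Consequences using (dec⇒weaklyDec)
open import Relation.Binary.PropositionalEquality as ≡ using (_≢_)
open import Relation.Nullary using (Dec; does; yes; no)

-- Integers are sent to
-- the optimised multiples (_×_ of TCOptimised), under which the constants 0 and 1 evaluate to 0# and
-- 1# definitionally, as the solver requires.
module IntegerCoefficientSolver {c ℓ} (R : CommutativeRing c ℓ) where
  open import Data.Integer public using (+_)
  open CommutativeRing R
  open import Algebra.Properties.Ring ring using (-‿distribˡ-*; -‿distribʳ-*)
  open import Algebra.Properties.AbelianGroup +-abelianGroup
    using (⁻¹-involutive; ε⁻¹≈ε; ⁻¹-∙-comm; ⁻¹-anti-homo‿-)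
  open import Algebra.Properties.Semiring.Mult.TCOptimised semiring
    using (_×_; ×-homo-+; ×1-homo-*)
  open import Relation.Binary.Reasoning.Setoid setoid

  fromℤ : ℤ → Carrier
  fromℤ (+ n)    = n × 1#
  fromℤ -[1+ n ] = - (suc n × 1#)

  fromℤ-neg : ∀ i → fromℤ (ℤ.- i) ≈ - fromℤ i
  fromℤ-neg -[1+ n ]  = sym (⁻¹-involutive _)
  fromℤ-neg (+ zero)  = sym ε⁻¹≈ε
  fromℤ-neg (+ suc n) = refl

  ×1-∸ : ∀ {m n} → n ℕ.≤ m → (m ℕ.∸ n) × 1# ≈ m × 1# - n × 1#
  ×1-∸ {m} {n} n≤m = begin
    (m ℕ.∸ n) × 1#                      ≈⟨ sym (+-identityʳ _) ⟩
    (m ℕ.∸ n) × 1# + 0#                 ≈⟨ +-congˡ (sym (-‿inverseʳ _)) ⟩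
    (m ℕ.∸ n) × 1# + (n × 1# - n × 1#)  ≈⟨ sym (+-assoc _ _ _) ⟩
    ((m ℕ.∸ n) × 1# + n × 1#) - n × 1#  ≈⟨ +-congʳ (sym (×-homo-+ 1# (m ℕ.∸ n) n)) ⟩
    (m ℕ.∸ n ℕ.+ n) × 1# - n × 1#       ≡⟨ ≡.cong (λ k → k × 1# - n × 1#) (ℕ.m∸n+n≡m n≤m) ⟩
    m × 1# - n × 1#                     ∎

  fromℤ-⊖ : ∀ m n → fromℤ (m ⊖ n) ≈ m × 1# - n × 1#
  fromℤ-⊖ m n with n ℕ.≤? m
  ... | yes n≤m = begin
    fromℤ (m ⊖ n)         ≡⟨ ≡.cong fromℤ (ℤ.⊖-≥ n≤m) ⟩
    (m ℕ.∸ n) × 1#        ≈⟨ ×1-∸ n≤m ⟩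
    m × 1# - n × 1#       ∎
  ... | no n≰m = begin
    fromℤ (m ⊖ n)             ≡⟨ ≡.cong fromℤ (ℤ.⊖-≰ n≰m) ⟩
    fromℤ (ℤ.- + (n ℕ.∸ m))   ≈⟨ fromℤ-neg (+ (n ℕ.∸ m)) ⟩
    - ((n ℕ.∸ m) × 1#)        ≈⟨ -‿cong (×1-∸ (ℕ.≰⇒≥ n≰m)) ⟩
    - (n × 1# - m × 1#)       ≈⟨ ⁻¹-anti-homo‿- _ _ ⟩
    m × 1# - n × 1#           ∎

  fromℤ-+ : ∀ i j → fromℤ (i ℤ.+ j) ≈ fromℤ i + fromℤ j
  fromℤ-+ (+ m)    (+ n)    = ×-homo-+ 1# m n
  fromℤ-+ (+ m)    -[1+ n ] = fromℤ-⊖ m (suc n)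
  fromℤ-+ -[1+ m ] (+ n)    = trans (fromℤ-⊖ n (suc m)) (+-comm _ _)
  fromℤ-+ -[1+ m ] -[1+ n ] = begin
    fromℤ (-[1+ m ] ℤ.+ -[1+ n ])      ≡⟨ ≡.cong fromℤ (≡.sym (ℤ.neg-distrib-+ (+ suc m) (+ suc n))) ⟩
    fromℤ (ℤ.- (+ suc m ℤ.+ + suc n))  ≈⟨ fromℤ-neg (+ suc m ℤ.+ + suc n) ⟩
    - fromℤ (+ suc m ℤ.+ + suc n)      ≈⟨ -‿cong (fromℤ-+ (+ suc m) (+ suc n)) ⟩
    - (suc m × 1# + suc n × 1#)        ≈⟨ sym (⁻¹-∙-comm _ _) ⟩
    fromℤ -[1+ m ] + fromℤ -[1+ n ]    ∎

  fromℤ-*-pos : ∀ m n → fromℤ (+ m ℤ.* + n) ≈ m × 1# * n × 1#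
  fromℤ-*-pos m n = begin
    fromℤ (+ m ℤ.* + n)    ≡⟨ ≡.cong fromℤ (≡.sym (ℤ.pos-* m n)) ⟩
    (m ℕ.* n) × 1#         ≈⟨ ×1-homo-* m n ⟩
    m × 1# * n × 1#        ∎

  fromℤ-*-nonneg : ∀ m j → fromℤ (+ m ℤ.* j) ≈ m × 1# * fromℤ j
  fromℤ-*-nonneg m (+ n)    = fromℤ-*-pos m n
  fromℤ-*-nonneg m -[1+ n ] = begin
    fromℤ (+ m ℤ.* -[1+ n ])        ≡⟨ ≡.cong fromℤ (≡.sym (ℤ.neg-distribʳ-* (+ m) (+ suc n))) ⟩
    fromℤ (ℤ.- (+ m ℤ.* + suc n))   ≈⟨ fromℤ-neg (+ m ℤ.* + suc n) ⟩
    - fromℤ (+ m ℤ.* + suc n)       ≈⟨ -‿cong (fromℤ-*-pos m (suc n)) ⟩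
    - (m × 1# * suc n × 1#)         ≈⟨ -‿distribʳ-* _ _ ⟩
    m × 1# * fromℤ -[1+ n ]         ∎

  fromℤ-* : ∀ i j → fromℤ (i ℤ.* j) ≈ fromℤ i * fromℤ j
  fromℤ-* (+ m)    j = fromℤ-*-nonneg m j
  fromℤ-* -[1+ m ] j = begin
    fromℤ (-[1+ m ] ℤ.* j)          ≡⟨ ≡.cong fromℤ (≡.sym (ℤ.neg-distribˡ-* (+ suc m) j)) ⟩
    fromℤ (ℤ.- (+ suc m ℤ.* j))     ≈⟨ fromℤ-neg (+ suc m ℤ.* j) ⟩
    - fromℤ (+ suc m ℤ.* j)         ≈⟨ -‿cong (fromℤ-*-nonneg (suc m) j) ⟩
    - (suc m × 1# * fromℤ j)        ≈⟨ -‿distribˡ-* _ _ ⟩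
    fromℤ -[1+ m ] * fromℤ j        ∎

  fromℤ-homomorphism : ℤ.+-*-rawRing -Raw-AlmostCommutative⟶ fromCommutativeRing R
  fromℤ-homomorphism = record
    { ⟦_⟧    = fromℤ
    ; +-homo = fromℤ-+
    ; *-homo = fromℤ-*
    ; -‿homo = fromℤ-neg
    ; 0-homo = refl
    ; 1-homo = refl
    }

  fromℤ-≈? : ∀ i j → Maybe.Maybe (fromℤ i ≈ fromℤ j)
  fromℤ-≈? i j = Maybe.map (λ { ≡.refl → refl }) (dec⇒weaklyDec ℤ._≟_ i j)

  open Algebra.Solver.Ring ℤ.+-*-rawRing (fromCommutativeRing R) fromℤ-homomorphism fromℤ-≈? public

module FiniteSums {c ℓ} (R : CommutativeRing c ℓ) where
  open CommutativeRing R
  open IntegerCoefficientSolver R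
  open import Algebra.Properties.CommutativeSemigroup +-commutativeSemigroup
    using (interchange)
  open import Relation.Binary.Reasoning.Setoid setoid

  ∑< : ℕ → (ℕ → Carrier) → Carrier
  ∑< zero    f = 0#
  ∑< (suc n) f = f 0 + ∑< n (f ∘ suc)

  infix 5 ∑<
  syntax ∑< n (λ i → e) = ∑[ i < n ] e

  ∑-cong : ∀ n {f g : ℕ → Carrier} → (∀ i → i < n → f i ≈ g i) → ∑< n f ≈ ∑< n g
  ∑-cong zero    f≈g = refl
  ∑-cong (suc n) f≈g = +-cong (f≈g 0 (s≤s z≤n)) (∑-cong n (λ i i<n → f≈g (suc i) (s≤s i<n)))

  ∑-0 : ∀ n → (∑[ i < n ] 0#) ≈ 0#
  ∑-0 zero    = refl
  ∑-0 (suc n) = trans (+-identityˡ _) (∑-0 n)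

  ∑-+ : ∀ n (f g : ℕ → Carrier) → (∑[ i < n ] f i + g i) ≈ ∑< n f + ∑< n g
  ∑-+ zero    f g = sym (+-identityˡ 0#)
  ∑-+ (suc n) f g = trans (+-congˡ (∑-+ n (f ∘ suc) (g ∘ suc))) (interchange _ _ _ _)

  ∑-- : ∀ n (f g : ℕ → Carrier) → (∑[ i < n ] f i - g i) ≈ ∑< n f - ∑< n g
  ∑-- zero    f g = sym (-‿inverseʳ 0#)
  ∑-- (suc n) f g = trans (+-congˡ (∑-- n (f ∘ suc) (g ∘ suc)))
    (solve 4 (λ a b c d → (a :- b) :+ (c :- d) := (a :+ c) :- (b :+ d)) refl (f 0) (g 0) (∑< n (f ∘ suc)) (∑< n (g ∘ suc)))

  ∑-*ˡ : ∀ n x (f : ℕ → Carrier) → (∑[ i < n ] x * f i) ≈ x * ∑< n f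
  ∑-*ˡ zero    x f = sym (zeroʳ x)
  ∑-*ˡ (suc n) x f = trans (+-congˡ (∑-*ˡ n x (f ∘ suc))) (sym (distribˡ x _ _))

  ∑-snoc : ∀ n (f : ℕ → Carrier) → ∑< (suc n) f ≈ ∑< n f + f n
  ∑-snoc zero    f = trans (+-identityʳ _) (sym (+-identityˡ _))
  ∑-snoc (suc n) f = trans (+-congˡ (∑-snoc n (f ∘ suc))) (sym (+-assoc _ _ _))

  ∑-split : ∀ m n (f : ℕ → Carrier) → ∑< (m ℕ.+ n) f ≈ ∑< m f + (∑[ i < n ] f (m ℕ.+ i))
  ∑-split zero    n f = sym (+-identityˡ _)
  ∑-split (suc m) n f = trans (+-congˡ (∑-split m n (f ∘ suc))) (sym (+-assoc _ _ _))

  ∑-blocks : ∀ M a (f : ℕ → Carrier) → ∑< (M ℕ.* a) f ≈ (∑[ q < M ] ∑[ r < a ] f (q ℕ.* a ℕ.+ r))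
  ∑-blocks zero    a f = refl
  ∑-blocks (suc M) a f = begin
    ∑< (a ℕ.+ M ℕ.* a) f
      ≈⟨ ∑-split a (M ℕ.* a) f ⟩
    ∑< a f + (∑[ i < M ℕ.* a ] f (a ℕ.+ i))
      ≈⟨ +-congˡ (∑-blocks M a (λ i → f (a ℕ.+ i))) ⟩
    ∑< a f + (∑[ q < M ] ∑[ r < a ] f (a ℕ.+ (q ℕ.* a ℕ.+ r)))
      ≈⟨ +-congˡ (∑-cong M (λ q _ → ∑-cong a (λ r _ →
           reflexive (≡.cong f (≡.sym (ℕ.+-assoc a (q ℕ.* a) r)))))) ⟩
    (∑[ q < suc M ] ∑[ r < a ] f (q ℕ.* a ℕ.+ r)) ∎

  ∑-swap : ∀ M a (f : ℕ → ℕ → Carrier) → (∑[ q < M ] ∑[ r < a ] f q r) ≈ (∑[ r < a ] ∑[ q < M ] f q r)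
  ∑-swap zero    a f = sym (∑-0 a)
  ∑-swap (suc M) a f = trans (+-congˡ (∑-swap M a (f ∘ suc))) (sym (∑-+ a (f 0) _))

  ∑-truncate : ∀ {t M} (f : ℕ → Carrier) → t ≤ M → (∀ q → t ≤ q → f q ≈ 0#) → ∑< M f ≈ ∑< t f
  ∑-truncate {zero}  {M}     f _         f≈0 = trans (∑-cong M (λ q _ → f≈0 q z≤n)) (∑-0 M)
  ∑-truncate {suc t} {suc M} f (s≤s t≤M) f≈0 =
    +-congˡ (∑-truncate (f ∘ suc) t≤M (λ q t≤q → f≈0 (suc q) (s≤s t≤q)))

  ∑-single : ∀ {n B} (f : ℕ → Carrier) → n < B → (∀ i → i ≢ n → f i ≈ 0#) → ∑< B f ≈ f n
  ∑-single {zero}  {suc B} f _         f≈0 =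
    trans (+-congˡ (trans (∑-cong B (λ i _ → f≈0 (suc i) λ ())) (∑-0 B))) (+-identityʳ _)
  ∑-single {suc n} {suc B} f (s≤s n<B) f≈0 =
    trans (+-cong (f≈0 0 λ ()) (∑-single (f ∘ suc) n<B (λ i i≢n → f≈0 (suc i) (i≢n ∘ ℕ.suc-injective))))
          (+-identityˡ _)

module PowerSums {c ℓ} (R : CommutativeRing c ℓ) where
  open CommutativeRing R
  open RingOps R
  open FiniteSums R
  open IntegerCoefficientSolver R
  open import Relation.Binary.Reasoning.Setoid setoid

  ι-+ : ∀ m n → ι (m ℕ.+ n) ≈ ι m + ι n
  ι-+ zero    n = sym (+-identityˡ (ι n))
  ι-+ (suc m) n = trans (+-congˡ (ι-+ m n)) (sym (+-assoc 1# (ι m) (ι n)))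

  ι-* : ∀ m n → ι (m ℕ.* n) ≈ ι m * ι n
  ι-* zero    n = sym (zeroˡ (ι n))
  ι-* (suc m) n = begin
    ι (n ℕ.+ m ℕ.* n)      ≈⟨ ι-+ n (m ℕ.* n) ⟩
    ι n + ι (m ℕ.* n)      ≈⟨ +-cong (sym (*-identityˡ (ι n))) (ι-* m n) ⟩
    1# * ι n + ι m * ι n   ≈⟨ sym (distribʳ (ι n) 1# (ι m)) ⟩
    (1# + ι m) * ι n       ∎

  ^-+ : ∀ x m n → x ^ (m ℕ.+ n) ≈ x ^ m * x ^ n
  ^-+ x zero    n = sym (*-identityˡ _)
  ^-+ x (suc m) n = trans (*-congˡ (^-+ x m n)) (sym (*-assoc _ _ _))

  ^-periodic : ∀ {x a} → x ^ a ≈ 1# → ∀ q r → x ^ (q ℕ.* a ℕ.+ r) ≈ x ^ r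
  ^-periodic         x^a≈1 zero    r = refl
  ^-periodic {x} {a} x^a≈1 (suc q) r = begin
    x ^ (a ℕ.+ q ℕ.* a ℕ.+ r)     ≡⟨ ≡.cong (x ^_) (ℕ.+-assoc a (q ℕ.* a) r) ⟩
    x ^ (a ℕ.+ (q ℕ.* a ℕ.+ r))   ≈⟨ ^-+ x a (q ℕ.* a ℕ.+ r) ⟩
    x ^ a * x ^ (q ℕ.* a ℕ.+ r)   ≈⟨ *-cong x^a≈1 (^-periodic x^a≈1 q r) ⟩
    1# * x ^ r                    ≈⟨ *-identityˡ _ ⟩
    x ^ r                         ∎

  Q : ℕ → Carrier → Carrier
  Q a y = y * y - ι a * y

  ∑-progression : ∀ a r t →
    (1# + 1#) * ι a * (∑[ q < t ] ι (q ℕ.* a ℕ.+ r)) ≈ Q a (ι (t ℕ.* a ℕ.+ r)) - Q a (ι r)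
  ∑-progression a r zero = solve 2 (λ A y → con (+ 2) :* A :* con (+ 0) := (y :* y :- A :* y) :- (y :* y :- A :* y)) refl (ι a) (ι r)
  ∑-progression a r (suc t) = begin
    (1# + 1#) * ι a * (∑[ q < suc t ] ι (q ℕ.* a ℕ.+ r))
      ≈⟨ *-congˡ (∑-snoc t _) ⟩
    (1# + 1#) * ι a * ((∑[ q < t ] ι (q ℕ.* a ℕ.+ r)) + y)
      ≈⟨ distribˡ _ _ _ ⟩
    (1# + 1#) * ι a * (∑[ q < t ] ι (q ℕ.* a ℕ.+ r)) + (1# + 1#) * ι a * y
      ≈⟨ +-congʳ (∑-progression a r t) ⟩
    Q a y - Q a (ι r) + (1# + 1#) * ι a * y
      ≈⟨ solve 3 (λ A y Qr → (y :* y :- A :* y) :- Qr :+ con (+ 2) :* A :* y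
                           := ((A :+ y) :* (A :+ y) :- A :* (A :+ y)) :- Qr) refl (ι a) y (Q a (ι r)) ⟩
    Q a (ι a + y) - Q a (ι r)
      ≈⟨ +-congʳ (Q-cong (sym next)) ⟩
    Q a (ι (suc t ℕ.* a ℕ.+ r)) - Q a (ι r) ∎
    where
    y = ι (t ℕ.* a ℕ.+ r)
    next : ι (suc t ℕ.* a ℕ.+ r) ≈ ι a + y
    next = trans (reflexive (≡.cong ι (ℕ.+-assoc a (t ℕ.* a) r))) (ι-+ a (t ℕ.* a ℕ.+ r))
    Q-cong : ∀ {y z} → y ≈ z → Q a y ≈ Q a z
    Q-cong y≈z = +-cong (*-cong y≈z y≈z) (-‿cong (*-congˡ y≈z))

  module _ (x : Carrier) where

    ∑-geometric : ∀ n → (x - 1#) * (∑[ r < n ] x ^ r) ≈ x ^ n - 1#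
    ∑-geometric zero = solve 1 (λ x → (x :- con (+ 1)) :* con (+ 0) := con (+ 1) :- con (+ 1)) refl x
    ∑-geometric (suc n) = begin
      (x - 1#) * (∑[ r < suc n ] x ^ r)      ≈⟨ *-congˡ (∑-snoc n _) ⟩
      (x - 1#) * ((∑[ r < n ] x ^ r) + x ^ n) ≈⟨ distribˡ _ _ _ ⟩
      (x - 1#) * (∑[ r < n ] x ^ r) + (x - 1#) * x ^ n ≈⟨ +-congʳ (∑-geometric n) ⟩
      (x ^ n - 1#) + (x - 1#) * x ^ n
        ≈⟨ solve 2 (λ x p → (p :- con (+ 1)) :+ (x :- con (+ 1)) :* p := x :* p :- con (+ 1)) refl x (x ^ n) ⟩
      x ^ suc n - 1# ∎

    ∑-geometric-ι : ∀ n → (x - 1#) * (∑[ r < n ] x ^ r * ι r) ≈ ι n * x ^ n - x * (∑[ r < n ] x ^ r)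
    ∑-geometric-ι zero = solve 1 (λ x → (x :- con (+ 1)) :* con (+ 0) := con (+ 0) :* con (+ 1) :- x :* con (+ 0)) refl x
    ∑-geometric-ι (suc n) = begin
      (x - 1#) * (∑[ r < suc n ] x ^ r * ι r)                       ≈⟨ *-congˡ (∑-snoc n _) ⟩
      (x - 1#) * ((∑[ r < n ] x ^ r * ι r) + x ^ n * ι n)            ≈⟨ distribˡ _ _ _ ⟩
      (x - 1#) * (∑[ r < n ] x ^ r * ι r) + (x - 1#) * (x ^ n * ι n) ≈⟨ +-congʳ (∑-geometric-ι n) ⟩
      (ι n * x ^ n - x * P) + (x - 1#) * (x ^ n * ι n)
        ≈⟨ solve 4 (λ x p i P → (i :* p :- x :* P) :+ (x :- con (+ 1)) :* (p :* i)
                              := (con (+ 1) :+ i) :* (x :* p) :- x :* (P :+ p)) refl x (x ^ n) (ι n) P ⟩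
      ι (suc n) * x ^ suc n - x * (P + x ^ n)                     ≈⟨ +-congˡ (-‿cong (*-congˡ (sym (∑-snoc n _)))) ⟩
      ι (suc n) * x ^ suc n - x * (∑[ r < suc n ] x ^ r)             ∎
      where P = ∑[ r < n ] x ^ r

    ∑-geometric-ι² : ∀ n → (x - 1#) * (∑[ r < n ] x ^ r * (ι r * ι r))
      ≈ ι n * ι n * x ^ n - x * ((1# + 1#) * (∑[ r < n ] x ^ r * ι r) + (∑[ r < n ] x ^ r))
    ∑-geometric-ι² zero = solve 1 (λ x → (x :- con (+ 1)) :* con (+ 0)
      := con (+ 0) :* con (+ 0) :* con (+ 1) :- x :* (con (+ 2) :* con (+ 0) :+ con (+ 0))) refl x
    ∑-geometric-ι² (suc n) = begin
      (x - 1#) * (∑[ r < suc n ] x ^ r * (ι r * ι r))                             ≈⟨ *-congˡ (∑-snoc n _) ⟩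
      (x - 1#) * ((∑[ r < n ] x ^ r * (ι r * ι r)) + x ^ n * (ι n * ι n))          ≈⟨ distribˡ _ _ _ ⟩
      (x - 1#) * (∑[ r < n ] x ^ r * (ι r * ι r)) + (x - 1#) * (x ^ n * (ι n * ι n)) ≈⟨ +-congʳ (∑-geometric-ι² n) ⟩
      (ι n * ι n * x ^ n - x * ((1# + 1#) * U + P)) + (x - 1#) * (x ^ n * (ι n * ι n))
        ≈⟨ solve 5 (λ x p i P U → (i :* i :* p :- x :* (con (+ 2) :* U :+ P)) :+ (x :- con (+ 1)) :* (p :* (i :* i))
                   := (con (+ 1) :+ i) :* (con (+ 1) :+ i) :* (x :* p) :- x :* (con (+ 2) :* (U :+ p :* i) :+ (P :+ p)))
                   refl x (x ^ n) (ι n) P U ⟩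
      ι (suc n) * ι (suc n) * x ^ suc n - x * ((1# + 1#) * (U + x ^ n * ι n) + (P + x ^ n))
        ≈⟨ +-congˡ (-‿cong (*-congˡ (+-cong (*-congˡ (sym (∑-snoc n _))) (sym (∑-snoc n _))))) ⟩
      ι (suc n) * ι (suc n) * x ^ suc n - x * ((1# + 1#) * (∑[ r < suc n ] x ^ r * ι r) + (∑[ r < suc n ] x ^ r)) ∎
      where
      P = ∑[ r < n ] x ^ r
      U = ∑[ r < n ] x ^ r * ι r

  module AtRootOfUnity {x v : Carrier} {a : ℕ} (x^a≈1 : x ^ a ≈ 1#) (v[x-1]²≈1 : v * (x - 1#) ^ 2 ≈ 1#) where

    cancel-x-1 : ∀ {y z} → (x - 1#) * y ≈ z → y ≈ v * (x - 1#) * z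
    cancel-x-1 {y} {z} eq = begin
      y                              ≈⟨ sym (*-identityˡ y) ⟩
      1# * y                         ≈⟨ *-congʳ (sym v[x-1]²≈1) ⟩
      v * (x - 1#) ^ 2 * y           ≈⟨ solve 3 (λ v x y → v :* ((x :- con (+ 1)) :* ((x :- con (+ 1)) :* con (+ 1))) :* y
                                              := v :* (x :- con (+ 1)) :* ((x :- con (+ 1)) :* y)) refl v x y ⟩
      v * (x - 1#) * ((x - 1#) * y)  ≈⟨ *-congˡ eq ⟩
      v * (x - 1#) * z               ∎

    ∑-root : (∑[ r < a ] x ^ r) ≈ 0#
    ∑-root = begin
      (∑[ r < a ] x ^ r)      ≈⟨ cancel-x-1 (∑-geometric x a) ⟩
      v * (x - 1#) * (x ^ a - 1#) ≈⟨ *-congˡ (+-congʳ x^a≈1) ⟩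
      v * (x - 1#) * (1# - 1#)    ≈⟨ solve 2 (λ v x → v :* (x :- con (+ 1)) :* (con (+ 1) :- con (+ 1)) := con (+ 0)) refl v x ⟩
      0#                          ∎

    ∑-root-ι : (x - 1#) * (∑[ r < a ] x ^ r * ι r) ≈ ι a
    ∑-root-ι = begin
      (x - 1#) * (∑[ r < a ] x ^ r * ι r)  ≈⟨ ∑-geometric-ι x a ⟩
      ι a * x ^ a - x * (∑[ r < a ] x ^ r) ≈⟨ +-cong (*-congˡ x^a≈1) (-‿cong (*-congˡ ∑-root)) ⟩
      ι a * 1# - x * 0#                    ≈⟨ solve 2 (λ A x → A :* con (+ 1) :- x :* con (+ 0) := A) refl (ι a) x ⟩
      ι a                                  ∎

    ∑-root-ι² : (x - 1#) * (∑[ r < a ] x ^ r * (ι r * ι r)) ≈ ι a * ι a - x * ((1# + 1#) * (∑[ r < a ] x ^ r * ι r))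
    ∑-root-ι² = begin
      (x - 1#) * (∑[ r < a ] x ^ r * (ι r * ι r))                   ≈⟨ ∑-geometric-ι² x a ⟩
      ι a * ι a * x ^ a - x * ((1# + 1#) * U + (∑[ r < a ] x ^ r)) ≈⟨ +-cong (*-congˡ x^a≈1) (-‿cong (*-congˡ (+-congˡ ∑-root))) ⟩
      ι a * ι a * 1# - x * ((1# + 1#) * U + 0#)
        ≈⟨ solve 3 (λ A x U → A :* A :* con (+ 1) :- x :* (con (+ 2) :* U :+ con (+ 0)) := A :* A :- x :* (con (+ 2) :* U)) refl (ι a) x U ⟩
      ι a * ι a - x * ((1# + 1#) * U)                               ∎
      where U = ∑[ r < a ] x ^ r * ι r

    ∑-root-Q : (∑[ r < a ] x ^ r * Q a (ι r)) ≈ - ((1# + 1#) * ι a * x * v)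
    ∑-root-Q = begin
      S                                          ≈⟨ cancel-x-1 [x-1]S ⟩
      v * (x - 1#) * - ((1# + 1#) * x * U)       ≈⟨ solve 3 (λ v x U → v :* (x :- con (+ 1)) :* :- (con (+ 2) :* x :* U)
                                                        := :- (con (+ 2) :* x :* v :* ((x :- con (+ 1)) :* U))) refl v x U ⟩
      - ((1# + 1#) * x * v * ((x - 1#) * U))     ≈⟨ -‿cong (*-congˡ ∑-root-ι) ⟩
      - ((1# + 1#) * x * v * ι a)                ≈⟨ -‿cong (solve 3 (λ x v A → con (+ 2) :* x :* v :* A := con (+ 2) :* A :* x :* v) refl x v (ι a)) ⟩
      - ((1# + 1#) * ι a * x * v)                ∎
      where
      S = ∑[ r < a ] x ^ r * Q a (ι r)
      U = ∑[ r < a ] x ^ r * ι r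
      V = ∑[ r < a ] x ^ r * (ι r * ι r)
      S≈V-aU : S ≈ V - ι a * U
      S≈V-aU = begin
        S  ≈⟨ ∑-cong a (λ r _ → solve 3 (λ p y A → p :* (y :* y :- A :* y) := p :* (y :* y) :- A :* (p :* y)) refl (x ^ r) (ι r) (ι a)) ⟩
        (∑[ r < a ] x ^ r * (ι r * ι r) - ι a * (x ^ r * ι r)) ≈⟨ ∑-- a _ _ ⟩
        V - (∑[ r < a ] ι a * (x ^ r * ι r))                   ≈⟨ +-congˡ (-‿cong (∑-*ˡ a (ι a) _)) ⟩
        V - ι a * U ∎
      [x-1]S : (x - 1#) * S ≈ - ((1# + 1#) * x * U)
      [x-1]S = begin
        (x - 1#) * S                                       ≈⟨ *-congˡ S≈V-aU ⟩
        (x - 1#) * (V - ι a * U)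
          ≈⟨ solve 4 (λ x V U A → (x :- con (+ 1)) :* (V :- A :* U) := (x :- con (+ 1)) :* V :- A :* ((x :- con (+ 1)) :* U))
                     refl x V U (ι a) ⟩
        (x - 1#) * V - ι a * ((x - 1#) * U)
          ≈⟨ +-cong ∑-root-ι² (-‿cong (*-congˡ ∑-root-ι)) ⟩
        ι a * ι a - x * ((1# + 1#) * U) - ι a * ι a
          ≈⟨ solve 3 (λ A x U → A :* A :- x :* (con (+ 2) :* U) :- A :* A := :- (con (+ 2) :* x :* U)) refl (ι a) x U ⟩
        - ((1# + 1#) * x * U)                              ∎

module ListSums {c ℓ} (R : CommutativeRing c ℓ) where
  open CommutativeRing R
  open RingOps R
  open FiniteSums R
  open import Relation.Binary.Reasoning.Setoid setoid

  _restrictedTo_ : (ℕ → Carrier) → List ℕ → ℕ → Carrier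
  (f restrictedTo L) n = if does (n ∈? L) then f n else 0#

  restrictedTo-∈ : ∀ f L {n} → n ∈ L → (f restrictedTo L) n ≈ f n
  restrictedTo-∈ f L {n} n∈L with n ∈? L
  ... | yes _   = refl
  ... | no n∉L = ⊥-elim (n∉L n∈L)

  restrictedTo-∉ : ∀ f L {n} → n ∉ L → (f restrictedTo L) n ≈ 0#
  restrictedTo-∉ f L {n} n∉L with n ∈? L
  ... | yes n∈L = ⊥-elim (n∉L n∈L)
  ... | no _    = refl

  restrictedTo-∷ : ∀ f {x L} → x ∉ L → ∀ n →
    (f restrictedTo (x ∷ L)) n ≈ (f restrictedTo [ x ]) n + (f restrictedTo L) n
  restrictedTo-∷ f {x} {L} x∉L n with n ℕ.≟ x
  ... | yes ≡.refl = begin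
    (f restrictedTo (x ∷ L)) x                        ≈⟨ restrictedTo-∈ f (x ∷ L) (here ≡.refl) ⟩
    f x                                               ≈⟨ sym (+-identityʳ _) ⟩
    f x + 0#                                          ≈⟨ sym (+-cong (restrictedTo-∈ f [ x ] (here ≡.refl)) (restrictedTo-∉ f L x∉L)) ⟩
    (f restrictedTo [ x ]) x + (f restrictedTo L) x   ∎
  ... | no n≢x = begin
    (f restrictedTo (x ∷ L)) n                        ≈⟨ n∈x∷L⇔n∈L (n ∈? L) ⟩
    (f restrictedTo L) n                              ≈⟨ sym (+-identityˡ _) ⟩
    0# + (f restrictedTo L) n                         ≈⟨ +-congʳ (sym (restrictedTo-∉ f [ x ] λ { (here n≡x) → n≢x n≡x })) ⟩
    (f restrictedTo [ x ]) n + (f restrictedTo L) n   ∎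
    where
    n∈x∷L⇔n∈L : Dec (n ∈ L) → (f restrictedTo (x ∷ L)) n ≈ (f restrictedTo L) n
    n∈x∷L⇔n∈L (yes n∈L) = trans (restrictedTo-∈ f (x ∷ L) (there n∈L)) (sym (restrictedTo-∈ f L n∈L))
    n∈x∷L⇔n∈L (no n∉L)  = trans (restrictedTo-∉ f (x ∷ L) λ { (here n≡x) → n≢x n≡x ; (there n∈L) → n∉L n∈L })
                                 (sym (restrictedTo-∉ f L n∉L))

  Σ-restrictedTo : ∀ {B} L f → Unique L → All (_< B) L → Σ[ L ] f ≈ (∑[ n < B ] (f restrictedTo L) n)
  Σ-restrictedTo {B} []      f _           _          = sym (∑-0 B)
  Σ-restrictedTo {B} (x ∷ L) f (x≢L ∷ L!) (x<B ∷ L<B) = begin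
    f x + Σ[ L ] f
      ≈⟨ +-cong (sym (trans (∑-single (f restrictedTo [ x ]) x<B (λ i i≢x → restrictedTo-∉ f [ x ] λ { (here i≡x) → i≢x i≡x }))
                            (restrictedTo-∈ f [ x ] (here ≡.refl))))
                (Σ-restrictedTo L f L! L<B) ⟩
    (∑[ n < B ] (f restrictedTo [ x ]) n) + (∑[ n < B ] (f restrictedTo L) n)
      ≈⟨ sym (∑-+ B _ _) ⟩
    (∑[ n < B ] (f restrictedTo [ x ]) n + (f restrictedTo L) n)
      ≈⟨ sym (∑-cong B (λ n _ → restrictedTo-∷ f (All¬⇒¬Any x≢L) n)) ⟩
    (∑[ n < B ] (f restrictedTo (x ∷ L)) n) ∎

  Σ-applyUpTo : ∀ (h : ℕ → Carrier) g n → Σ[ applyUpTo g n ] h ≡ (∑[ i < n ] h (g i))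
  Σ-applyUpTo h g zero    = ≡.refl
  Σ-applyUpTo h g (suc n) = ≡.cong (λ s → h (g 0) + s) (Σ-applyUpTo h (g ∘ suc) n)

  Σ-map-suc-upTo : ∀ (h : ℕ → Carrier) n → Σ[ map suc (upTo n) ] h ≡ (∑[ i < n ] h (suc i))
  Σ-map-suc-upTo h n = ≡.trans (≡.cong (Σ[_] h) (List.map-applyUpTo (λ i → i) suc n)) (Σ-applyUpTo h suc n)

∈⇒≤sum : ∀ {n ns} → n ∈ ns → n ≤ sum ns
∈⇒≤sum {ns = n′ ∷ ns} (here ≡.refl) = ℕ.m≤m+n n′ (sum ns)
∈⇒≤sum {ns = n′ ∷ ns} (there n∈) = ℕ.≤-trans (∈⇒≤sum n∈) (ℕ.m≤n+m (sum ns) n′)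

bounded⇒≤ : ∀ {t M} → (∀ {q} → q < t → q < M) → t ≤ M
bounded⇒≤ {zero}  _ = z≤n
bounded⇒≤ {suc t} h = h (ℕ.n<1+n t)

module Representability (a : ℕ) .{{_ : NonZero a}} (as : List ℕ) where
  open import Data.Nat using (_+_; _*_)
  open ≡ using (refl; sym; trans; cong; subst)
  open ≡.≡-Reasoning

  regroup : ∀ x s j a → x * a + s + j * a ≡ (x + j) * a + s
  regroup = solve-∀

  zipWith-replicate-0 : ∀ bs → sum (zipWith _*_ (replicate (length bs) 0) bs) ≡ 0
  zipWith-replicate-0 []       = refl
  zipWith-replicate-0 (_ ∷ bs) = zipWith-replicate-0 bs

  InR-generator : InR (a ∷ as) a
  InR-generator = ℕ.>-nonZero⁻¹ a , (1 ∷ replicate (length as) 0) ,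
    cong suc (List.length-replicate (length as)) ,
    sym (trans (cong (a + 0 +_) (zipWith-replicate-0 as)) (trans (ℕ.+-identityʳ (a + 0)) (ℕ.+-identityʳ a)))

  InR-+-multiple : ∀ {n} j → InR (a ∷ as) n → InR (a ∷ as) (n + j * a)
  InR-+-multiple {n} j (0<n , (x ∷ xs) , len , n≡) =
    ℕ.<-≤-trans 0<n (ℕ.m≤m+n n (j * a)) , (x + j) ∷ xs , len , (begin
      n + j * a                                   ≡⟨ cong (_+ j * a) n≡ ⟩
      x * a + sum (zipWith _*_ xs as) + j * a     ≡⟨ regroup x (sum (zipWith _*_ xs as)) j a ⟩
      (x + j) * a + sum (zipWith _*_ xs as)       ∎)

  InR-multiple : ∀ q → InR (a ∷ as) (suc q * a)
  InR-multiple q = InR-+-multiple q InR-generator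

  q*a+r≡r[mod-a] : ∀ q r → (q * a + r) ≡ r [mod a ]
  q*a+r≡r[mod-a] q r = subst (a ∣_) (sym ∣q*a+r-r∣≡q*a) (n∣m*n q)
    where
    ∣q*a+r-r∣≡q*a : ∣ q * a + r - r ∣ ≡ q * a
    ∣q*a+r-r∣≡q*a = trans (ℕ.m≤n⇒∣n-m∣≡n∸m (ℕ.m≤n+m r (q * a))) (ℕ.m+n∸n≡m (q * a) r)

  ≡[mod]⇒%≡ : ∀ {m r} → r < a → m ≡ r [mod a ] → m % a ≡ r
  ≡[mod]⇒%≡ {m} {r} r<a a∣ with r ℕ.≤? m
  ... | yes r≤m = begin
    m % a            ≡⟨ cong (_% a) (sym (ℕ.m∸n+n≡m r≤m)) ⟩
    (m ∸ r + r) % a  ≡⟨ %-remove-+ˡ r (subst (a ∣_) (ℕ.m≤n⇒∣n-m∣≡n∸m r≤m) a∣) ⟩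
    r % a            ≡⟨ m<n⇒m%n≡m r<a ⟩
    r                ∎
  ... | no r≰m = ⊥-elim (ℕ.<-irrefl refl (ℕ.<-≤-trans r<a (ℕ.≤-trans a≤r∸m (ℕ.m∸n≤m r m))))
    where
    m<r = ℕ.≰⇒> r≰m
    a≤r∸m : a ≤ r ∸ m
    a≤r∸m = ∣⇒≤ {{ℕ.>-nonZero (ℕ.m<n⇒0<n∸m m<r)}} (subst (a ∣_) (ℕ.m≤n⇒∣m-n∣≡n∸m (ℕ.<⇒≤ m<r)) a∣)

  module LeastRepresentative {r m : ℕ} (least : IsLeastRep (a ∷ as) a r m) (0<r : 0 < r) (r<a : r < a) where

    quotient : ℕ
    quotient = m / a

    m≡quotient*a+r : m ≡ quotient * a + r
    m≡quotient*a+r = begin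
      m                 ≡⟨ m≡m%n+[m/n]*n m a ⟩
      m % a + m / a * a ≡⟨ cong (_+ m / a * a) (≡[mod]⇒%≡ r<a (proj₁ (proj₁ least))) ⟩
      r + m / a * a     ≡⟨ ℕ.+-comm r (m / a * a) ⟩
      m / a * a + r     ∎

    ¬InR-below : ∀ {q} → q < quotient → ¬ InR (a ∷ as) (q * a + r)
    ¬InR-below {q} q<t inR = ℕ.<⇒≱ q<t (ℕ.*-cancelʳ-≤ quotient q a (ℕ.+-cancelʳ-≤ r _ _ m≤q*a+r))
      where
      m≤q*a+r : quotient * a + r ≤ q * a + r
      m≤q*a+r = subst (_≤ q * a + r) m≡quotient*a+r
        (proj₂ least (q * a + r) (ℕ.<-≤-trans 0<r (ℕ.m≤n+m r (q * a))) (q*a+r≡r[mod-a] q r) inR)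

    InR-above : ∀ {q} → quotient ≤ q → InR (a ∷ as) (q * a + r)
    InR-above {q} t≤q = subst (InR (a ∷ as)) m+[q∸t]*a≡q*a+r (InR-+-multiple (q ∸ quotient) (proj₂ (proj₁ least)))
      where
      m+[q∸t]*a≡q*a+r : m + (q ∸ quotient) * a ≡ q * a + r
      m+[q∸t]*a≡q*a+r = begin
        m + (q ∸ quotient) * a                    ≡⟨ cong (_+ (q ∸ quotient) * a) m≡quotient*a+r ⟩
        quotient * a + r + (q ∸ quotient) * a     ≡⟨ regroup quotient r (q ∸ quotient) a ⟩
        (quotient + (q ∸ quotient)) * a + r       ≡⟨ cong (λ s → s * a + r) (ℕ.m+[n∸m]≡n t≤q) ⟩
        q * a + r                                 ∎

module NonRepresentableSum (k : ℕ) (as : List ℕ) (m : ℕ → ℕ)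
  (least : ∀ i → 1 ≤ i → i ≤ k → IsLeastRep (suc k ∷ as) (suc k) i (m i))
  (NR : List ℕ) (NR-unique : Unique NR) (NR-spec : ∀ n → n ∈ NR ⇔ InNR (suc k ∷ as) n)
  where

  a : ℕ
  a = suc k

  open Representability a as
  open Equivalence

  module Residue {r} (r<k : r < k) = LeastRepresentative (least (suc r) (s≤s z≤n) r<k) (s≤s z≤n) (s≤s r<k)

  t : ℕ → ℕ
  t r = m r / a

  ∈NR-below : ∀ {q r} → r < k → q < t (suc r) → q ℕ.* a ℕ.+ suc r ∈ NR
  ∈NR-below {q} {r} r<k q<t = from (NR-spec _) (ℕ.<-≤-trans (s≤s z≤n) (ℕ.m≤n+m (suc r) (q ℕ.* a)) , Residue.¬InR-below r<k q<t)

  ∉NR-above : ∀ {q r} → r < k → t (suc r) ≤ q → q ℕ.* a ℕ.+ suc r ∉ NR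
  ∉NR-above r<k t≤q q*a+r∈NR = proj₂ (to (NR-spec _) q*a+r∈NR) (Residue.InR-above r<k t≤q)

  ∉NR-multiple : ∀ q → q ℕ.* a ℕ.+ 0 ∉ NR
  ∉NR-multiple q q*a∈NR with q | to (NR-spec _) q*a∈NR
  ... | zero  | () , _
  ... | suc q | _ , ¬InR = ¬InR (≡.subst (InR (a ∷ as)) (≡.sym (ℕ.+-identityʳ _)) (InR-multiple q))

  M : ℕ
  M = suc (sum NR)

  NR-bounded : All (_< M ℕ.* a) NR
  NR-bounded = All.tabulate λ n∈NR → ℕ.≤-trans (s≤s (∈⇒≤sum n∈NR)) (ℕ.m≤m*n M a)

  t≤M : ∀ {r} → r < k → t (suc r) ≤ M
  t≤M {r} r<k = bounded⇒≤ λ {q} q<t →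
    s≤s (ℕ.≤-trans (ℕ.≤-trans (ℕ.m≤m*n q a) (ℕ.m≤m+n (q ℕ.* a) (suc r))) (∈⇒≤sum (∈NR-below r<k q<t)))

  module _ {c ℓ} (R : CommutativeRing c ℓ) where
    open CommutativeRing R
    open RingOps R
    open FiniteSums R
    open ListSums R
    open PowerSums R
    open IntegerCoefficientSolver R
    open import Algebra.Properties.AbelianGroup +-abelianGroup using (⁻¹-involutive)
    open import Relation.Binary.Reasoning.Setoid setoid

    module _ {x : Carrier} (x^a≈1 : x ^ a ≈ 1#) where

      f : ℕ → Carrier
      f n = x ^ n * ι n

      ∑-residue-0 : (∑[ q < M ] (f restrictedTo NR) (q ℕ.* a ℕ.+ 0)) ≈ 0#
      ∑-residue-0 = trans (∑-cong M (λ q _ → restrictedTo-∉ f NR (∉NR-multiple q))) (∑-0 M)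

      ∑-residue : ∀ {r} → r < k →
        (∑[ q < M ] (f restrictedTo NR) (q ℕ.* a ℕ.+ suc r)) ≈ x ^ suc r * (∑[ q < t (suc r) ] ι (q ℕ.* a ℕ.+ suc r))
      ∑-residue {r} r<k = begin
        (∑[ q < M ] (f restrictedTo NR) (q ℕ.* a ℕ.+ suc r))
          ≈⟨ ∑-truncate (λ q → (f restrictedTo NR) (q ℕ.* a ℕ.+ suc r)) (t≤M r<k)
                        (λ q t≤q → restrictedTo-∉ f NR (∉NR-above r<k t≤q)) ⟩
        (∑[ q < t (suc r) ] (f restrictedTo NR) (q ℕ.* a ℕ.+ suc r))
          ≈⟨ ∑-cong (t (suc r)) (λ q q<t → trans (restrictedTo-∈ f NR (∈NR-below r<k q<t))
                                                 (*-congʳ (^-periodic x^a≈1 q (suc r)))) ⟩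
        (∑[ q < t (suc r) ] x ^ suc r * ι (q ℕ.* a ℕ.+ suc r))
          ≈⟨ ∑-*ˡ (t (suc r)) (x ^ suc r) _ ⟩
        x ^ suc r * (∑[ q < t (suc r) ] ι (q ℕ.* a ℕ.+ suc r)) ∎

      Σ-NR : Σ[ NR ] f ≈ (∑[ r < k ] x ^ suc r * (∑[ q < t (suc r) ] ι (q ℕ.* a ℕ.+ suc r)))
      Σ-NR = begin
        Σ[ NR ] f                                                  ≈⟨ Σ-restrictedTo NR f NR-unique NR-bounded ⟩
        (∑[ n < M ℕ.* a ] (f restrictedTo NR) n)                   ≈⟨ ∑-blocks M a (f restrictedTo NR) ⟩
        (∑[ q < M ] ∑[ r < a ] (f restrictedTo NR) (q ℕ.* a ℕ.+ r)) ≈⟨ ∑-swap M a (λ q r → (f restrictedTo NR) (q ℕ.* a ℕ.+ r)) ⟩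
        (∑[ r < a ] ∑[ q < M ] (f restrictedTo NR) (q ℕ.* a ℕ.+ r)) ≈⟨ +-cong ∑-residue-0 (∑-cong k (λ r r<k → ∑-residue r<k)) ⟩
        0# + (∑[ r < k ] x ^ suc r * (∑[ q < t (suc r) ] ι (q ℕ.* a ℕ.+ suc r))) ≈⟨ +-identityˡ _ ⟩
        (∑[ r < k ] x ^ suc r * (∑[ q < t (suc r) ] ι (q ℕ.* a ℕ.+ suc r))) ∎

      module _ {u v : Carrier} (u-inv : u * (ι 2 * ι a) ≈ 1#) (v-inv : v * (x - 1#) ^ 2 ≈ 1#) where
        open AtRootOfUnity {a = a} x^a≈1 v-inv

        X Y : Carrier
        X = ∑[ r < k ] ι (m (suc r) ℕ.* m (suc r)) * x ^ suc r
        Y = ∑[ r < k ] ι (m (suc r)) * x ^ suc r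

        residue-closed-form : ∀ {r} → r < k →
          (1# + 1#) * ι a * (x ^ suc r * (∑[ q < t (suc r) ] ι (q ℕ.* a ℕ.+ suc r)))
            ≈ (ι (m (suc r) ℕ.* m (suc r)) * x ^ suc r - ι a * (ι (m (suc r)) * x ^ suc r)) - x ^ suc r * Q a (ι (suc r))
        residue-closed-form {r} r<k = begin
          (1# + 1#) * ι a * (p * S)
            ≈⟨ solve 3 (λ c p S → c :* (p :* S) := p :* (c :* S)) refl ((1# + 1#) * ι a) p S ⟩
          p * ((1# + 1#) * ι a * S)
            ≈⟨ *-congˡ (∑-progression a (suc r) (t (suc r))) ⟩
          p * (Q a (ι (t (suc r) ℕ.* a ℕ.+ suc r)) - Q a (ι (suc r)))
            ≡⟨ ≡.cong (λ n → p * (Q a (ι n) - Q a (ι (suc r)))) (≡.sym (Residue.m≡quotient*a+r r<k)) ⟩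
          p * (Q a y - Q a (ι (suc r)))
            ≈⟨ solve 4 (λ p y A Qr → p :* ((y :* y :- A :* y) :- Qr) := (y :* y :* p :- A :* (y :* p)) :- p :* Qr)
                       refl p y (ι a) (Q a (ι (suc r))) ⟩
          (y * y * p - ι a * (y * p)) - p * Q a (ι (suc r))
            ≈⟨ +-congʳ (+-congʳ (*-congʳ (sym (ι-* (m (suc r)) (m (suc r)))))) ⟩
          (ι (m (suc r) ℕ.* m (suc r)) * p - ι a * (y * p)) - p * Q a (ι (suc r)) ∎
          where
          p = x ^ suc r
          y = ι (m (suc r))
          S = ∑[ q < t (suc r) ] ι (q ℕ.* a ℕ.+ suc r)

        ∑-root-Q-from-1 : (∑[ r < k ] x ^ suc r * Q a (ι (suc r))) ≈ - ((1# + 1#) * ι a * x * v)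
        ∑-root-Q-from-1 = begin
          (∑[ r < k ] x ^ suc r * Q a (ι (suc r)))            ≈⟨ sym (+-identityˡ _) ⟩
          0# + (∑[ r < k ] x ^ suc r * Q a (ι (suc r)))
            ≈⟨ +-congʳ (solve 1 (λ A → con (+ 0) := con (+ 1) :* (con (+ 0) :* con (+ 0) :- A :* con (+ 0))) refl (ι a)) ⟩
          (∑[ r < a ] x ^ r * Q a (ι r))                      ≈⟨ ∑-root-Q ⟩
          - ((1# + 1#) * ι a * x * v)                         ∎

        2a*Σ-NR : (1# + 1#) * ι a * Σ[ NR ] f ≈ (X - ι a * Y) + (1# + 1#) * ι a * x * v
        2a*Σ-NR = begin
          (1# + 1#) * ι a * Σ[ NR ] f
            ≈⟨ *-congˡ Σ-NR ⟩
          (1# + 1#) * ι a * (∑[ r < k ] x ^ suc r * (∑[ q < t (suc r) ] ι (q ℕ.* a ℕ.+ suc r)))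
            ≈⟨ sym (∑-*ˡ k _ _) ⟩
          (∑[ r < k ] (1# + 1#) * ι a * (x ^ suc r * (∑[ q < t (suc r) ] ι (q ℕ.* a ℕ.+ suc r))))
            ≈⟨ ∑-cong k (λ r r<k → residue-closed-form r<k) ⟩
          (∑[ r < k ] (ι (m (suc r) ℕ.* m (suc r)) * x ^ suc r - ι a * (ι (m (suc r)) * x ^ suc r)) - x ^ suc r * Q a (ι (suc r)))
            ≈⟨ ∑-- k _ _ ⟩
          (∑[ r < k ] ι (m (suc r) ℕ.* m (suc r)) * x ^ suc r - ι a * (ι (m (suc r)) * x ^ suc r)) - (∑[ r < k ] x ^ suc r * Q a (ι (suc r)))
            ≈⟨ +-cong (trans (∑-- k _ _) (+-congˡ (-‿cong (∑-*ˡ k (ι a) _)))) (-‿cong ∑-root-Q-from-1) ⟩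
          (X - ι a * Y) - - ((1# + 1#) * ι a * x * v)
            ≈⟨ +-congˡ (⁻¹-involutive _) ⟩
          (X - ι a * Y) + (1# + 1#) * ι a * x * v ∎

        closed-form : Σ[ NR ] f ≈ (u * Σ[ map suc (upTo k) ] (λ i → ι (m i ℕ.* m i) * x ^ i)
                                    - (u * ι a) * Σ[ map suc (upTo k) ] (λ i → ι (m i) * x ^ i)) + x * v
        closed-form = begin
          Σ[ NR ] f                                      ≈⟨ sym (*-identityˡ _) ⟩
          1# * Σ[ NR ] f                                 ≈⟨ *-congʳ (sym u-inv) ⟩
          u * (ι 2 * ι a) * Σ[ NR ] f                    ≈⟨ solve 4 (λ u two A L → u :* (two :* A) :* L := u :* (two :* A :* L)) refl u (ι 2) (ι a) _ ⟩
          u * (ι 2 * ι a * Σ[ NR ] f)                    ≈⟨ *-congˡ (trans (*-congʳ (*-congʳ ι2≈1+1)) 2a*Σ-NR) ⟩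
          u * ((X - ι a * Y) + (1# + 1#) * ι a * x * v)
            ≈⟨ solve 7 (λ u X Y A two x v → u :* ((X :- A :* Y) :+ two :* A :* x :* v) := (u :* X :- u :* A :* Y) :+ u :* (two :* A) :* (x :* v))
                       refl u X Y (ι a) (1# + 1#) x v ⟩
          (u * X - u * ι a * Y) + u * ((1# + 1#) * ι a) * (x * v)
            ≈⟨ +-congˡ (trans (*-congʳ (trans (*-congˡ (*-congʳ (sym ι2≈1+1))) u-inv)) (*-identityˡ _)) ⟩
          (u * X - u * ι a * Y) + x * v
            ≡⟨ ≡.cong₂ (λ X Y → (u * X - u * ι a * Y) + x * v)
                 (≡.sym (Σ-map-suc-upTo (λ i → ι (m i ℕ.* m i) * x ^ i) k)) (≡.sym (Σ-map-suc-upTo (λ i → ι (m i) * x ^ i) k)) ⟩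
          (u * Σ[ map suc (upTo k) ] (λ i → ι (m i ℕ.* m i) * x ^ i)
            - (u * ι a) * Σ[ map suc (upTo k) ] (λ i → ι (m i) * x ^ i)) + x * v ∎
          where
          ι2≈1+1 : ι 2 ≈ 1# + 1#
          ι2≈1+1 = +-congˡ (+-identityʳ 1#)

theorem4 : ∀ {c ℓ} (F : CharZeroField c ℓ) (a₁ : ℕ) (as : List ℕ) →
    1 ≤ length as →
    All (0 <_) (a₁ ∷ as) →
    gcdList (a₁ ∷ as) ≡ 1 →
    (m : ℕ → ℕ) →
    (∀ i → 1 ≤ i → i ≤ a₁ ∸ 1 → IsLeastRep (a₁ ∷ as) a₁ i (m i)) →
    (NR : List ℕ) → Unique NR → (∀ n → (n ∈ NR) ⇔ InNR (a₁ ∷ as) n) →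
    let open CharZeroField F in
    (λ' : Carrier) → ¬ (λ' ≈ 0#) → ¬ (λ' ≈ 1#) → λ' ^ a₁ ≈ 1# →
    (u v : Carrier) → u * (ι 2 * ι a₁) ≈ 1# → v * ((λ' - 1#) ^ 2) ≈ 1# →
    Σ[ NR ] (λ n → (λ' ^ n) * ι n)
      ≈ (u * Σ[ map suc (upTo (a₁ ∸ 1)) ] (λ i → ι (m i ℕ.* m i) * (λ' ^ i))
         - (u * ι a₁) * Σ[ map suc (upTo (a₁ ∸ 1)) ] (λ i → ι (m i) * (λ' ^ i)))
        + λ' * v
-- The gcd condition only serves to make the m_i exist, which is assumed here; λ ≠ 1 is implied by
-- the inverse v of (λ − 1)², and λ ≠ 0 by λ^a₁ = 1.
theorem4 F ℕ.zero  as _ (() ∷ _) _ _ _ _ _ _ _ _ _ _ _ _ _ _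
theorem4 F (suc k) as _ _ _ m least NR NR-unique NR-spec λ' _ _ λ'^a≈1 u v u-inv v-inv =
  NonRepresentableSum.closed-form k as m least NR NR-unique NR-spec (CharZeroField.cring F) λ'^a≈1 u-inv v-inv
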